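{- For every $n\ge 3$, the $2$-optimal rubbling number of the cycle $C_n$ is $n$; that is, the minimum size of a pebble distribution on $C_n$ from which every vertex is $2$-reachable is $n$.
   Context: $C_n$ is the cycle on $n$ vertices. A pebble distribution is a function $p:V\to\mathbb{Z}_{\ge0}$; its size is the total number of pebbles. A pebbling move along an edge $\{v,u\}$ removes two pebbles from $v$ and adds one at $u$; a strict rubbling move $(v,w\to u)$ with $v\neq w$ both adjacent to $u$ removes one pebble from each of $v,w$ and adds one at $u$; rubbling moves are either kind. A sequence of rubbling moves is executable if pebble counts stay nonnegative throughout. A vertex $v$ is $k$-reachable if some executable sequence ends with at least $k$ pebbles on $v$; a distribution is $k$-solvable if every vertex is $k$-reachable. The $2$-optimal rubbling number is the minimum size of a $2$-solvable distribution. -}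

module Defs where

open import Data.Nat using (ℕ; zero; suc; _+_; _%_; _≤_; NonZero)
open import Data.Fin using (Fin; toℕ)
open import Data.Sum using (_⊎_)
open import Data.Product using (_×_; Σ; ∃)
open import Relation.Binary.PropositionalEquality using (_≡_)
open import Relation.Nullary using (¬_)
open import Data.Vec.Functional using (foldr)

Adj : (n : ℕ) .{{_ : NonZero n}} → Fin n → Fin n → Set
Adj n u v = (toℕ v ≡ (toℕ u + 1) % n) ⊎ (toℕ u ≡ (toℕ v + 1) % n)

Dist : ℕ → Set
Dist n = Fin n → ℕ

size : ∀ {n} → Dist n → ℕ
size p = foldr _+_ 0 p

-- One rubbling move taking distribution p to distribution q
-- (nonnegativity of counts is automatic since counts are natural numbers).
data Move (n : ℕ) .{{_ : NonZero n}} (p q : Dist n) : Set where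
  pebbling : (v u : Fin n) → Adj n v u →
             q v + 2 ≡ p v → q u ≡ suc (p u) →
             (∀ x → ¬ x ≡ v → ¬ x ≡ u → q x ≡ p x) → Move n p q
  rubbling : (v w u : Fin n) → ¬ v ≡ w → Adj n v u → Adj n w u →
             q v + 1 ≡ p v → q w + 1 ≡ p w → q u ≡ suc (p u) →
             (∀ x → ¬ x ≡ v → ¬ x ≡ w → ¬ x ≡ u → q x ≡ p x) → Move n p q

data Reach (n : ℕ) .{{_ : NonZero n}} : Dist n → Dist n → Set where
  done : ∀ {p} → Reach n p p
  step : ∀ {p q r} → Move n p q → Reach n q r → Reach n p r

Reachable : (n : ℕ) .{{_ : NonZero n}} → ℕ → Dist n → Fin n → Set
Reachable n k p v = ∃ λ q → Reach n p q × k ≤ q v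

Solvable : (n : ℕ) .{{_ : NonZero n}} → ℕ → Dist n → Set
Solvable n k p = ∀ v → Reachable n k p v

IsOptimalRubblingNumber : (n : ℕ) .{{_ : NonZero n}} → ℕ → ℕ → Set
IsOptimalRubblingNumber n k m =
  (Σ (Dist n) λ p → Solvable n k p × size p ≡ m) ×
  (∀ (p : Dist n) → Solvable n k p → m ≤ size p)

module Submission where

-- Upper bound: one pebble on every vertex is 2-solvable.  The strict rubbling move
-- (n-1, 1 → 0) puts two pebbles on vertex 0, and rotating the cycle serves any vertex.
--
-- Lower bound, by a potential argument.  The path value of a sequence a₀, a₁, …, read
-- from its head, is a₀ + ⌊(a₁ + ⌊(a₂ + …)/2⌋)/2⌋.  Seen from a vertex t, a distribution has
-- potential 2·p(t) + F(t) + G(t), where F(t), G(t) are the path values of the two arcs of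
-- the cycle leaving t.  No rubbling move increases the potential, and it is at least 4
-- once t carries two pebbles; so a 2-solvable p has 4 ≤ 2·p(t) + F(t) + G(t) for all t.
-- Moreover F(t+1) ≤ p(t) + ⌊F(t)/2⌋ and G(t-1) ≤ p(t) + ⌊G(t)/2⌋, whence
--   2 + (F(t+1) ∸ 1) + (G(t-1) ∸ 1) ≤ 2·p(t) + (F(t) ∸ 1) + (G(t) ∸ 1),
-- and summing this around the cycle telescopes to 2n ≤ 2·size p.

open import Defs
open import Data.Nat using (ℕ; zero; suc; _+_; _*_; _∸_; _≤_; _<_; z≤n; s≤s; s≤s⁻¹; _%_; NonZero; ⌊_/2⌋; _<?_)
open import Data.Nat.Properties
open import Data.Nat.DivMod using (m%n<n; m<n⇒m%n≡m; n%n≡0; [m+n]%n≡m%n; %-distribˡ-+; m%n%n≡m%n)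
open import Data.Fin using (Fin; toℕ; fromℕ; fromℕ<) renaming (zero to fz; suc to fs)
open import Data.Fin.Properties using (toℕ-injective; toℕ<n; toℕ-fromℕ<; toℕ-fromℕ) renaming (_≟_ to _≟ᶠ_)
open import Data.Product using (_×_; _,_)
open import Data.Sum using (_⊎_; inj₁; inj₂)
open import Relation.Binary.PropositionalEquality
open import Relation.Nullary using (¬_; yes; no)
open import Data.Empty using (⊥-elim)
open import Data.Nat.Solver using (module +-*-Solver)
open +-*-Solver

⌊1+n/2⌋≤1+⌊n/2⌋ : ∀ s → ⌊ suc s /2⌋ ≤ suc ⌊ s /2⌋
⌊1+n/2⌋≤1+⌊n/2⌋ zero = z≤n
⌊1+n/2⌋≤1+⌊n/2⌋ (suc zero) = s≤s z≤n
⌊1+n/2⌋≤1+⌊n/2⌋ (suc (suc s)) = s≤s (⌊1+n/2⌋≤1+⌊n/2⌋ s)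

+-mono-slack : ∀ {a b c d x y} → a + x ≤ b → c + y ≤ d → a + c + (x + y) ≤ b + d
+-mono-slack {a} {b} {c} {d} {x} {y} h₁ h₂ = ≤-trans (≤-reflexive regroup) (+-mono-≤ h₁ h₂)
  where
  regroup : a + c + (x + y) ≡ a + x + (c + y)
  regroup = solve 4 (λ a c x y → a :+ c :+ (x :+ y) := a :+ x :+ (c :+ y)) refl a c x y

shiftSeq : (ℕ → ℕ) → ℕ → ℕ
shiftSeq a i = a (suc i)

-- The path value of a 0, a 1, …, a (k-1), read from the head a 0:
--   a 0 + ⌊ (a 1 + ⌊ (a 2 + …) / 2 ⌋) / 2 ⌋,
-- the number of pebbles that pebbling moves can bring to the head of a path carrying them.
pathValue : (ℕ → ℕ) → ℕ → ℕ
pathValue a zero = 0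
pathValue a (suc k) = a 0 + ⌊ pathValue (shiftSeq a) k /2⌋

pathValue-mono : ∀ k {a b : ℕ → ℕ} → (∀ i → i < k → b i ≤ a i) → pathValue b k ≤ pathValue a k
pathValue-mono zero le = z≤n
pathValue-mono (suc k) le =
  +-mono-≤ (le 0 (s≤s z≤n)) (⌊n/2⌋-mono (pathValue-mono k (λ i i<k → le (suc i) (s≤s i<k))))

pathValue-cong : ∀ k {a b : ℕ → ℕ} → (∀ i → i < k → b i ≡ a i) → pathValue b k ≡ pathValue a k
pathValue-cong k eq = ≤-antisym (pathValue-mono k (λ i i<k → ≤-reflexive (eq i i<k)))
                                (pathValue-mono k (λ i i<k → ≤-reflexive (sym (eq i i<k))))

pathValue-extend : ∀ k (a : ℕ → ℕ) → pathValue a k ≤ pathValue a (suc k)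
pathValue-extend zero a = z≤n
pathValue-extend (suc k) a = +-monoʳ-≤ (a 0) (⌊n/2⌋-mono (pathValue-extend k (shiftSeq a)))

pathValue-bump : ∀ k j {a b : ℕ → ℕ} → (∀ i → i < k → ¬ i ≡ j → b i ≤ a i) → b j ≤ suc (a j) →
                 pathValue b k ≤ suc (pathValue a k)
pathValue-bump zero j le bump = z≤n
pathValue-bump (suc k) zero le bump =
  +-mono-≤ bump (⌊n/2⌋-mono (pathValue-mono k (λ i i<k → le (suc i) (s≤s i<k) (λ ()))))
pathValue-bump (suc k) (suc j) {a} {b} le bump = begin
    b 0 + ⌊ pathValue (shiftSeq b) k /2⌋       ≤⟨ +-mono-≤ (le 0 (s≤s z≤n) (λ ())) (⌊n/2⌋-mono tailBump) ⟩
    a 0 + ⌊ suc (pathValue (shiftSeq a) k) /2⌋ ≤⟨ +-monoʳ-≤ (a 0) (⌊1+n/2⌋≤1+⌊n/2⌋ _) ⟩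
    a 0 + suc ⌊ pathValue (shiftSeq a) k /2⌋   ≡⟨ +-suc (a 0) _ ⟩
    suc (a 0 + ⌊ pathValue (shiftSeq a) k /2⌋) ∎
  where
  open ≤-Reasoning
  tailBump : pathValue (shiftSeq b) k ≤ suc (pathValue (shiftSeq a) k)
  tailBump = pathValue-bump k j (λ i i<k i≢j → le (suc i) (s≤s i<k) (λ eq → i≢j (suc-injective eq))) bump

pathValue-head : ∀ k c {a b : ℕ → ℕ} → b 0 + c ≤ a 0 → (∀ i → i < k → b (suc i) ≤ a (suc i)) →
                 pathValue b (suc k) + c ≤ pathValue a (suc k)
pathValue-head k c {a} {b} drop le = begin
    b 0 + ⌊ pathValue (shiftSeq b) k /2⌋ + c ≡⟨ solve 3 (λ x h c → x :+ h :+ c := x :+ c :+ h) refl (b 0) _ c ⟩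
    b 0 + c + ⌊ pathValue (shiftSeq b) k /2⌋ ≤⟨ +-mono-≤ drop (⌊n/2⌋-mono (pathValue-mono k le)) ⟩
    a 0 + ⌊ pathValue (shiftSeq a) k /2⌋     ∎
  where open ≤-Reasoning

-- Moving a pebble away from the head (losing at least one at i, gaining one at i + 1)
-- does not raise the path value: the gain is halved before it reaches position i.
pathValue-outward : ∀ k i {a b : ℕ → ℕ} → suc i < k → b i + 1 ≤ a i → b (suc i) ≤ suc (a (suc i)) →
                    (∀ j → j < k → ¬ j ≡ suc i → b j ≤ a j) → pathValue b k ≤ pathValue a k
pathValue-outward (suc k) zero {a} {b} _ drop bump le = begin
    b 0 + ⌊ pathValue (shiftSeq b) k /2⌋       ≤⟨ +-monoʳ-≤ (b 0) (⌊n/2⌋-mono tailBump) ⟩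
    b 0 + ⌊ suc (pathValue (shiftSeq a) k) /2⌋ ≤⟨ +-monoʳ-≤ (b 0) (⌊1+n/2⌋≤1+⌊n/2⌋ _) ⟩
    b 0 + suc ⌊ pathValue (shiftSeq a) k /2⌋   ≡⟨ +-suc (b 0) _ ⟩
    suc (b 0) + ⌊ pathValue (shiftSeq a) k /2⌋ ≤⟨ +-monoˡ-≤ _ (subst (_≤ a 0) (+-comm (b 0) 1) drop) ⟩
    a 0 + ⌊ pathValue (shiftSeq a) k /2⌋       ∎
  where
  open ≤-Reasoning
  tailBump : pathValue (shiftSeq b) k ≤ suc (pathValue (shiftSeq a) k)
  tailBump = pathValue-bump k 0 (λ j j<k j≢0 → le (suc j) (s≤s j<k) (λ eq → j≢0 (suc-injective eq))) bump
pathValue-outward (suc k) (suc i) {a} {b} (s≤s i<k) drop bump le =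
  +-mono-≤ (le 0 (s≤s z≤n) (λ ()))
    (⌊n/2⌋-mono (pathValue-outward k i i<k drop bump (λ j j<k ne → le (suc j) (s≤s j<k) (λ eq → ne (suc-injective eq)))))

pathValue-inward : ∀ k i {a b : ℕ → ℕ} → suc i < k → b (suc i) + 2 ≤ a (suc i) → b i ≤ suc (a i) →
                   (∀ j → j < k → ¬ j ≡ i → b j ≤ a j) → pathValue b k ≤ pathValue a k
pathValue-inward (suc (suc k)) zero {a} {b} _ drop bump le = begin
    b 0 + ⌊ pathValue (shiftSeq b) (suc k) /2⌋       ≤⟨ +-monoˡ-≤ _ bump ⟩
    suc (a 0) + ⌊ pathValue (shiftSeq b) (suc k) /2⌋ ≡⟨ sym (+-suc (a 0) _) ⟩
    a 0 + ⌊ 2 + pathValue (shiftSeq b) (suc k) /2⌋   ≤⟨ +-monoʳ-≤ (a 0) (⌊n/2⌋-mono tailDrop) ⟩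
    a 0 + ⌊ pathValue (shiftSeq a) (suc k) /2⌋       ∎
  where
  open ≤-Reasoning
  tailDrop : 2 + pathValue (shiftSeq b) (suc k) ≤ pathValue (shiftSeq a) (suc k)
  tailDrop = subst (_≤ pathValue (shiftSeq a) (suc k)) (+-comm _ 2)
               (pathValue-head k 2 {shiftSeq a} {shiftSeq b} drop (λ j j<k → le (suc (suc j)) (s≤s (s≤s j<k)) (λ ())))
pathValue-inward (suc k) (suc i) {a} {b} (s≤s i<k) drop bump le =
  +-mono-≤ (le 0 (s≤s z≤n) (λ ()))
    (⌊n/2⌋-mono (pathValue-inward k i i<k drop bump (λ j j<k ne → le (suc j) (s≤s j<k) (λ eq → ne (suc-injective eq)))))

module Positions (m : ℕ) where
  M : ℕ
  M = suc (suc m)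
  n : ℕ
  n = suc M

  Neighbours : ℕ → ℕ → Set
  Neighbours a b = (b ≡ suc a) ⊎ (a ≡ suc b) ⊎ (a ≡ M × b ≡ 0) ⊎ (b ≡ M × a ≡ 0)

  -- A rubbling move from e to e', recorded by the inequalities it guarantees:
  -- the sources lose their pebbles, the target gains at most one, nothing else grows.
  data PosMove (e e' : ℕ → ℕ) : Set where
    pebbling : ∀ a b → a < n → b < n → Neighbours a b →
               e' a + 2 ≤ e a → e' b ≤ suc (e b) → (∀ i → ¬ i ≡ b → e' i ≤ e i) → PosMove e e'
    rubbling : ∀ x y c → x < n → y < n → c < n → Neighbours x c → Neighbours y c → ¬ x ≡ y →
               e' x + 1 ≤ e x → e' y + 1 ≤ e y → e' c ≤ suc (e c) →
               (∀ i → ¬ i ≡ c → e' i ≤ e i) → PosMove e e'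

  ccwArc : (ℕ → ℕ) → ℕ → ℕ
  ccwArc e k = e (M ∸ k)
  cwArc : (ℕ → ℕ) → ℕ → ℕ
  cwArc e k = e (suc k)

  potential : (ℕ → ℕ) → ℕ
  potential e = 2 * e 0 + pathValue (ccwArc e) M + pathValue (cwArc e) M

  module OneMove (e e' : ℕ → ℕ) where
    BelowExcept : ℕ → Set
    BelowExcept J = ∀ i → ¬ i ≡ J → e' i ≤ e i

    F F' G G' : ℕ
    F = pathValue (ccwArc e) M
    F' = pathValue (ccwArc e') M
    G = pathValue (cwArc e) M
    G' = pathValue (cwArc e') M

    ccw-below : ∀ J → BelowExcept J → ∀ k → k < M → ¬ k ≡ M ∸ J → ccwArc e' k ≤ ccwArc e k
    ccw-below J below k k<M k≢ = below (M ∸ k) (λ eq → k≢ (trans (sym (m∸[m∸n]≡n (<⇒≤ k<M))) (cong (M ∸_) eq)))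

    cw-below : ∀ j → BelowExcept (suc j) → ∀ k → ¬ k ≡ j → cwArc e' k ≤ cwArc e k
    cw-below j below k k≢j = below (suc k) (λ eq → k≢j (suc-injective eq))

    ccw-at : ∀ {J} → J ≤ M → M ∸ (M ∸ J) ≡ J
    ccw-at = m∸[m∸n]≡n

    ccw-next : ∀ x → suc x ≤ M → suc (M ∸ suc x) ≡ M ∸ x
    ccw-next x lt = sym (+-∸-assoc 1 lt)

    ccw-mono : BelowExcept 0 → F' ≤ F
    ccw-mono below = pathValue-mono M {ccwArc e} {ccwArc e'} (λ k k<M → below (M ∸ k) (λ eq → <⇒≢ (m<n⇒0<n∸m k<M) (sym eq)))

    cw-mono : BelowExcept 0 → G' ≤ G
    cw-mono below = pathValue-mono M {cwArc e} {cwArc e'} (λ k _ → below (suc k) (λ ()))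

    ccw-bump : ∀ J → J ≤ M → BelowExcept J → e' J ≤ suc (e J) → F' ≤ suc F
    ccw-bump J J≤M below bump =
      pathValue-bump M (M ∸ J) (ccw-below J below) (subst (λ z → e' z ≤ suc (e z)) (sym (ccw-at J≤M)) bump)

    cw-bump : ∀ j → BelowExcept (suc j) → e' (suc j) ≤ suc (e (suc j)) → G' ≤ suc G
    cw-bump j below bump = pathValue-bump M j (λ k _ k≢j → cw-below j below k k≢j) bump

    ccw-head : ∀ c → e' M + c ≤ e M → BelowExcept 0 → F' + c ≤ F
    ccw-head c drop below = pathValue-head (suc m) c {ccwArc e} {ccwArc e'} drop
      (λ k k<m → below (M ∸ suc k) (λ eq → <⇒≢ (m<n⇒0<n∸m (s≤s k<m)) (sym eq)))

    cw-head : ∀ c → e' 1 + c ≤ e 1 → BelowExcept 0 → G' + c ≤ G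
    cw-head c drop below = pathValue-head (suc m) c {cwArc e} {cwArc e'} drop (λ k _ → below (suc (suc k)) (λ ()))

    cw-outward : ∀ x → suc (suc x) ≤ M → e' (suc x) + 1 ≤ e (suc x) → e' (suc (suc x)) ≤ suc (e (suc (suc x))) →
                 BelowExcept (suc (suc x)) → G' ≤ G
    cw-outward x lt drop bump below = pathValue-outward M x lt drop bump (λ k _ k≢ → cw-below (suc x) below k k≢)

    cw-inward : ∀ j → suc (suc j) ≤ M → e' (suc (suc j)) + 2 ≤ e (suc (suc j)) → e' (suc j) ≤ suc (e (suc j)) →
                BelowExcept (suc j) → G' ≤ G
    cw-inward j lt drop bump below = pathValue-inward M j lt drop bump (λ k _ k≢ → cw-below j below k k≢)

    ccw-inward : ∀ x → 1 ≤ x → suc x ≤ M → e' x + 2 ≤ e x → e' (suc x) ≤ suc (e (suc x)) →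
                 BelowExcept (suc x) → F' ≤ F
    ccw-inward x 1≤x lt drop bump below = pathValue-inward M (M ∸ suc x)
      (subst (_< M) (sym (ccw-next x lt)) (∸-monoʳ-< 1≤x (≤-trans (n≤1+n x) lt)))
      (subst (λ z → e' z + 2 ≤ e z) (sym (trans (cong (M ∸_) (ccw-next x lt)) (ccw-at (≤-trans (n≤1+n x) lt)))) drop)
      (subst (λ z → e' z ≤ suc (e z)) (sym (ccw-at lt)) bump)
      (ccw-below (suc x) below)

    ccw-outward : ∀ j → 1 ≤ j → suc j ≤ M → e' (suc j) + 1 ≤ e (suc j) → e' j ≤ suc (e j) →
                  BelowExcept j → F' ≤ F
    ccw-outward j 1≤j lt drop bump below = pathValue-outward M (M ∸ suc j)
      (subst (_< M) (sym (ccw-next j lt)) (∸-monoʳ-< 1≤j (≤-trans (n≤1+n j) lt)))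
      (subst (λ z → e' z + 1 ≤ e z) (sym (ccw-at lt)) drop)
      (subst (λ z → e' z ≤ suc (e z)) (sym (trans (cong (M ∸_) (ccw-next j lt)) (ccw-at (≤-trans (n≤1+n j) lt)))) bump)
      (λ k k<M k≢ → ccw-below j below k k<M (λ eq → k≢ (trans eq (sym (ccw-next j lt)))))

    potential-away : e' 0 ≤ e 0 → F' ≤ F → G' ≤ G → potential e' ≤ potential e
    potential-away h₀ hF hG = +-mono-≤ (+-mono-≤ (*-monoʳ-≤ 2 h₀) hF) hG

    potential-from0 : e' 0 + 1 ≤ e 0 → F' ≤ suc F → G' ≤ suc G → potential e' ≤ potential e
    potential-from0 h₀ hF hG = begin
      2 * e' 0 + F' + G'           ≤⟨ +-mono-≤ (+-monoʳ-≤ (2 * e' 0) hF) hG ⟩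
      2 * e' 0 + suc F + suc G     ≡⟨ solve 3 (λ x f g → con 2 :* x :+ (con 1 :+ f) :+ (con 1 :+ g) := con 2 :* (x :+ con 1) :+ f :+ g) refl (e' 0) F G ⟩
      2 * (e' 0 + 1) + F + G       ≤⟨ +-monoˡ-≤ G (+-monoˡ-≤ F (*-monoʳ-≤ 2 h₀)) ⟩
      2 * e 0 + F + G              ∎
      where open ≤-Reasoning

    potential-to0 : ∀ x y → x + y ≡ 2 → e' 0 ≤ suc (e 0) → F' + x ≤ F → G' + y ≤ G → potential e' ≤ potential e
    potential-to0 x y x+y≡2 h₀ hF hG = begin
      2 * e' 0 + F' + G'           ≤⟨ +-monoˡ-≤ G' (+-monoˡ-≤ F' (*-monoʳ-≤ 2 h₀)) ⟩
      2 * suc (e 0) + F' + G'      ≡⟨ solve 3 (λ x f g → con 2 :* (con 1 :+ x) :+ f :+ g := con 2 :* x :+ (f :+ g :+ con 2)) refl (e 0) F' G' ⟩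
      2 * e 0 + (F' + G' + 2)      ≤⟨ +-monoʳ-≤ (2 * e 0) hFG ⟩
      2 * e 0 + (F + G)            ≡⟨ sym (+-assoc (2 * e 0) F G) ⟩
      2 * e 0 + F + G              ∎
      where
      open ≤-Reasoning
      hFG : F' + G' + 2 ≤ F + G
      hFG = subst (λ d → F' + G' + d ≤ F + G) x+y≡2 (+-mono-slack {F'} {F} {G'} {G} {x} {y} hF hG)

    rubbling-between : ∀ x → suc (suc x) < n → e' x + 1 ≤ e x → e' (suc (suc x)) + 1 ≤ e (suc (suc x)) →
                       e' (suc x) ≤ suc (e (suc x)) → BelowExcept (suc x) → potential e' ≤ potential e
    rubbling-between zero _ drop₁ _ bump below =
      potential-from0 drop₁ (ccw-bump 1 (s≤s z≤n) below bump) (cw-bump 0 below bump)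
    rubbling-between (suc x) x+2<n drop₁ drop₂ bump below =
      potential-away (below 0 (λ ())) (ccw-outward (suc (suc x)) (s≤s z≤n) (s≤s⁻¹ x+2<n) drop₂ bump below)
        (cw-outward x (≤-trans (n≤1+n _) (s≤s⁻¹ x+2<n)) drop₁ bump below)

    rubbling-toM : e' (suc m) + 1 ≤ e (suc m) → e' 0 + 1 ≤ e 0 → e' M ≤ suc (e M) → BelowExcept M →
                   potential e' ≤ potential e
    rubbling-toM _ drop₀ bump below = potential-from0 drop₀ (ccw-bump M ≤-refl below bump) (cw-bump (suc m) below bump)

    rubbling-to0 : e' M + 1 ≤ e M → e' 1 + 1 ≤ e 1 → e' 0 ≤ suc (e 0) → BelowExcept 0 → potential e' ≤ potential e
    rubbling-to0 dropM drop₁ bump below = potential-to0 1 1 refl bump (ccw-head 1 dropM below) (cw-head 1 drop₁ below)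

    decreases : PosMove e e' → potential e' ≤ potential e
    decreases (pebbling zero .1 _ _ (inj₁ refl) drop bump below) =
      potential-from0 (≤-trans (+-monoʳ-≤ (e' 0) (s≤s z≤n)) drop) (ccw-bump 1 (s≤s z≤n) below bump) (cw-bump 0 below bump)
    decreases (pebbling (suc a) .(suc (suc a)) _ b<n (inj₁ refl) drop bump below) =
      potential-away (below 0 (λ ())) (ccw-inward (suc a) (s≤s z≤n) (s≤s⁻¹ b<n) drop bump below)
        (cw-outward a (s≤s⁻¹ b<n) (≤-trans (+-monoʳ-≤ (e' (suc a)) (s≤s z≤n)) drop) bump below)
    decreases (pebbling .1 zero _ _ (inj₂ (inj₁ refl)) drop bump below) =
      potential-to0 0 2 refl bump (≤-trans (≤-reflexive (+-identityʳ F')) (ccw-mono below)) (cw-head 2 drop below)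
    decreases (pebbling .(suc (suc b)) (suc b) a<n _ (inj₂ (inj₁ refl)) drop bump below) =
      potential-away (below 0 (λ ()))
        (ccw-outward (suc b) (s≤s z≤n) (s≤s⁻¹ a<n) (≤-trans (+-monoʳ-≤ (e' (suc (suc b))) (s≤s z≤n)) drop) bump below)
        (cw-inward b (s≤s⁻¹ a<n) drop bump below)
    decreases (pebbling .M .0 _ _ (inj₂ (inj₂ (inj₁ (refl , refl)))) drop bump below) =
      potential-to0 2 0 refl bump (ccw-head 2 drop below) (≤-trans (≤-reflexive (+-identityʳ G')) (cw-mono below))
    decreases (pebbling .0 .M _ _ (inj₂ (inj₂ (inj₂ (refl , refl)))) drop bump below) =
      potential-from0 (≤-trans (+-monoʳ-≤ (e' 0) (s≤s z≤n)) drop) (ccw-bump M ≤-refl below bump) (cw-bump (suc m) below bump)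
    decreases (rubbling x .(suc (suc x)) .(suc x) _ y<n _ (inj₁ refl) (inj₂ (inj₁ refl)) _ dx dy bump below) =
      rubbling-between x y<n dx dy bump below
    decreases (rubbling .(suc (suc y)) y .(suc y) x<n _ _ (inj₂ (inj₁ refl)) (inj₁ refl) _ dx dy bump below) =
      rubbling-between y x<n dy dx bump below
    decreases (rubbling .(suc m) .0 .M _ _ _ (inj₁ refl) (inj₂ (inj₂ (inj₂ (refl , refl)))) _ dx dy bump below) =
      rubbling-toM dx dy bump below
    decreases (rubbling .0 .(suc m) .M _ _ _ (inj₂ (inj₂ (inj₂ (refl , refl)))) (inj₁ refl) _ dx dy bump below) =
      rubbling-toM dy dx bump below
    decreases (rubbling .M .1 .0 _ _ _ (inj₂ (inj₂ (inj₁ (refl , refl)))) (inj₂ (inj₁ refl)) _ dx dy bump below) =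
      rubbling-to0 dx dy bump below
    decreases (rubbling .1 .M .0 _ _ _ (inj₂ (inj₁ refl)) (inj₂ (inj₂ (inj₁ (refl , refl)))) _ dx dy bump below) =
      rubbling-to0 dy dx bump below
    decreases (rubbling x .x .(suc x) _ _ _ (inj₁ refl) (inj₁ refl) x≢y _ _ _ _) = ⊥-elim (x≢y refl)
    decreases (rubbling .(suc c) .(suc c) c _ _ _ (inj₂ (inj₁ refl)) (inj₂ (inj₁ refl)) x≢y _ _ _ _) = ⊥-elim (x≢y refl)
    decreases (rubbling _ _ _ _ _ _ (inj₂ (inj₂ (inj₁ (refl , refl)))) (inj₂ (inj₂ (inj₁ (refl , _)))) x≢y _ _ _ _) = ⊥-elim (x≢y refl)
    decreases (rubbling _ _ _ _ _ _ (inj₂ (inj₂ (inj₂ (refl , refl)))) (inj₂ (inj₂ (inj₂ (_ , refl)))) x≢y _ _ _ _) = ⊥-elim (x≢y refl)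
    decreases (rubbling _ _ _ _ _ _ (inj₁ refl) (inj₂ (inj₂ (inj₁ (_ , ())))) _ _ _ _ _)
    decreases (rubbling _ _ _ _ _ _ (inj₂ (inj₂ (inj₁ (refl , refl)))) (inj₁ ()) _ _ _ _ _)
    decreases (rubbling _ _ _ x<n _ _ (inj₂ (inj₁ refl)) (inj₂ (inj₂ (inj₂ (refl , refl)))) _ _ _ _ _) = ⊥-elim (<-irrefl refl x<n)
    decreases (rubbling _ _ _ _ y<n _ (inj₂ (inj₂ (inj₂ (refl , refl)))) (inj₂ (inj₁ refl)) _ _ _ _ _) = ⊥-elim (<-irrefl refl y<n)
    decreases (rubbling _ _ _ _ _ _ (inj₂ (inj₂ (inj₁ (refl , refl)))) (inj₂ (inj₂ (inj₂ (() , _)))) _ _ _ _ _)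
    decreases (rubbling _ _ _ _ _ _ (inj₂ (inj₂ (inj₂ (refl , refl)))) (inj₂ (inj₂ (inj₁ (_ , ())))) _ _ _ _ _)

  potential-mono : ∀ {e e'} → PosMove e e' → potential e' ≤ potential e
  potential-mono {e} {e'} = OneMove.decreases e e'

-- A distribution on Fin k read as a sequence on ℕ, extended by zero from position k on.
toSeq : ∀ {k} → (Fin k → ℕ) → ℕ → ℕ
toSeq {zero} r i = 0
toSeq {suc k} r zero = r fz
toSeq {suc k} r (suc i) = toSeq (λ x → r (fs x)) i

toSeq-toℕ : ∀ {k} (r : Fin k → ℕ) x → toSeq r (toℕ x) ≡ r x
toSeq-toℕ r fz = refl
toSeq-toℕ r (fs x) = toSeq-toℕ (λ y → r (fs y)) x

toSeq-beyond : ∀ {k} (r : Fin k → ℕ) i → k ≤ i → toSeq r i ≡ 0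
toSeq-beyond {zero} r i _ = refl
toSeq-beyond {suc k} r (suc i) (s≤s k≤i) = toSeq-beyond (λ y → r (fs y)) i k≤i

toSeq-fromℕ< : ∀ {k} (r : Fin k → ℕ) i (i<k : i < k) → toSeq r i ≡ r (fromℕ< i<k)
toSeq-fromℕ< r i i<k = trans (cong (toSeq r) (sym (toℕ-fromℕ< i<k))) (toSeq-toℕ r (fromℕ< i<k))

[m%d+k]%d≡[m+k]%d : ∀ y k d .{{_ : NonZero d}} → (y % d + k) % d ≡ (y + k) % d
[m%d+k]%d≡[m+k]%d y k d = begin
    (y % d + k) % d             ≡⟨ %-distribˡ-+ (y % d) k d ⟩
    (y % d % d + k % d) % d     ≡⟨ cong (λ z → (z + k % d) % d) (m%n%n≡m%n y d) ⟩
    (y % d + k % d) % d         ≡⟨ sym (%-distribˡ-+ y k d) ⟩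
    (y + k) % d                 ∎
  where open ≡-Reasoning

module Cycle (m : ℕ) where
  open Positions m public

  successor-mod : ∀ x y → x < n → y ≡ (x + 1) % n → (y ≡ suc x) ⊎ (x ≡ M × y ≡ 0)
  successor-mod x y x<n y≡ with m≤n⇒m<n∨m≡n (s≤s⁻¹ x<n)
  ... | inj₁ x<M = inj₁ (trans y≡ (trans (m<n⇒m%n≡m (subst (_< n) (+-comm 1 x) (s≤s x<M))) (+-comm x 1)))
  ... | inj₂ refl = inj₂ (refl , trans y≡ (trans (cong (_% n) (+-comm M 1)) (n%n≡0 n)))

  adjacent⇒neighbours : ∀ {v u} → Adj n v u → Neighbours (toℕ v) (toℕ u)
  adjacent⇒neighbours {v} {u} (inj₁ u≡) with successor-mod (toℕ v) (toℕ u) (toℕ<n v) u≡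
  ... | inj₁ eq = inj₁ eq
  ... | inj₂ eq = inj₂ (inj₂ (inj₁ eq))
  adjacent⇒neighbours {v} {u} (inj₂ v≡) with successor-mod (toℕ u) (toℕ v) (toℕ<n u) v≡
  ... | inj₁ eq = inj₂ (inj₁ eq)
  ... | inj₂ (u≡M , v≡0) = inj₂ (inj₂ (inj₂ (u≡M , v≡0)))

  toSeq-below : (r s : Fin n → ℕ) (J : Fin n) → (∀ x → ¬ x ≡ J → s x ≤ r x) →
                ∀ i → ¬ i ≡ toℕ J → toSeq s i ≤ toSeq r i
  toSeq-below r s J below i i≢J with i <? n
  ... | yes i<n = subst₂ _≤_ (sym (toSeq-fromℕ< s i i<n)) (sym (toSeq-fromℕ< r i i<n))
                    (below (fromℕ< i<n) (λ eq → i≢J (trans (sym (toℕ-fromℕ< i<n)) (cong toℕ eq))))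
  ... | no i≮n = ≤-reflexive (trans (toSeq-beyond s i (≮⇒≥ i≮n)) (sym (toSeq-beyond r i (≮⇒≥ i≮n))))

  toPosMove : ∀ {r s} → Move n r s → PosMove (toSeq r) (toSeq s)
  toPosMove {r} {s} (pebbling v u adj vLoses uGains rest) =
    pebbling (toℕ v) (toℕ u) (toℕ<n v) (toℕ<n u) (adjacent⇒neighbours adj)
      (≤-reflexive (subst₂ (λ a b → a + 2 ≡ b) (sym (toSeq-toℕ s v)) (sym (toSeq-toℕ r v)) vLoses))
      (≤-reflexive (subst₂ (λ a b → a ≡ suc b) (sym (toSeq-toℕ s u)) (sym (toSeq-toℕ r u)) uGains))
      (toSeq-below r s u below)
    where
    below : ∀ x → ¬ x ≡ u → s x ≤ r x
    below x x≢u with x ≟ᶠ v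
    ... | yes refl = m+n≤o⇒m≤o (s x) (≤-reflexive vLoses)
    ... | no x≢v = ≤-reflexive (rest x x≢v x≢u)
  toPosMove {r} {s} (rubbling v w u v≢w av aw vLoses wLoses uGains rest) =
    rubbling (toℕ v) (toℕ w) (toℕ u) (toℕ<n v) (toℕ<n w) (toℕ<n u)
      (adjacent⇒neighbours av) (adjacent⇒neighbours aw) (λ eq → v≢w (toℕ-injective eq))
      (≤-reflexive (subst₂ (λ a b → a + 1 ≡ b) (sym (toSeq-toℕ s v)) (sym (toSeq-toℕ r v)) vLoses))
      (≤-reflexive (subst₂ (λ a b → a + 1 ≡ b) (sym (toSeq-toℕ s w)) (sym (toSeq-toℕ r w)) wLoses))
      (≤-reflexive (subst₂ (λ a b → a ≡ suc b) (sym (toSeq-toℕ s u)) (sym (toSeq-toℕ r u)) uGains))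
      (toSeq-below r s u below)
    where
    below : ∀ x → ¬ x ≡ u → s x ≤ r x
    below x x≢u with x ≟ᶠ v | x ≟ᶠ w
    ... | yes refl | _ = m+n≤o⇒m≤o (s x) (≤-reflexive vLoses)
    ... | no _ | yes refl = m+n≤o⇒m≤o (s x) (≤-reflexive wLoses)
    ... | no x≢v | no x≢w = ≤-reflexive (rest x x≢v x≢w x≢u)

  potential-reach : ∀ {r s} → Reach n r s → potential (toSeq s) ≤ potential (toSeq r)
  potential-reach done = ≤-refl
  potential-reach (step mv rest) = ≤-trans (potential-reach rest) (potential-mono (toPosMove mv))

  shift : ℕ → Fin n → Fin n
  shift t x = fromℕ< (m%n<n (toℕ x + t) n)

  toℕ-shift : ∀ t x → toℕ (shift t x) ≡ (toℕ x + t) % n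
  toℕ-shift t x = toℕ-fromℕ< (m%n<n (toℕ x + t) n)

  rotate : ℕ → (Fin n → ℕ) → Fin n → ℕ
  rotate t r x = r (shift t x)

  shift-inverse : ∀ a b x → a + b ≡ n → shift a (shift b x) ≡ x
  shift-inverse a b x a+b≡n = toℕ-injective (begin
      toℕ (shift a (shift b x))   ≡⟨ toℕ-shift a (shift b x) ⟩
      (toℕ (shift b x) + a) % n   ≡⟨ cong (λ z → (z + a) % n) (toℕ-shift b x) ⟩
      ((toℕ x + b) % n + a) % n   ≡⟨ [m%d+k]%d≡[m+k]%d (toℕ x + b) a n ⟩
      (toℕ x + b + a) % n         ≡⟨ cong (_% n) (trans (+-assoc (toℕ x) b a) (cong (toℕ x +_) (trans (+-comm b a) a+b≡n))) ⟩
      (toℕ x + n) % n             ≡⟨ [m+n]%n≡m%n (toℕ x) n ⟩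
      toℕ x % n                   ≡⟨ m<n⇒m%n≡m (toℕ<n x) ⟩
      toℕ x                       ∎)
    where open ≡-Reasoning

  shift-adjacent : ∀ t {x y} → Adj n x y → Adj n (shift t x) (shift t y)
  shift-adjacent t {x} {y} (inj₁ y≡) = inj₁ (successor-shift x y y≡)
    where
    successor-shift : ∀ x y → toℕ y ≡ (toℕ x + 1) % n → toℕ (shift t y) ≡ (toℕ (shift t x) + 1) % n
    successor-shift x y y≡ = begin
      toℕ (shift t y)               ≡⟨ toℕ-shift t y ⟩
      (toℕ y + t) % n               ≡⟨ cong (λ z → (z + t) % n) y≡ ⟩
      ((toℕ x + 1) % n + t) % n     ≡⟨ [m%d+k]%d≡[m+k]%d (toℕ x + 1) t n ⟩
      (toℕ x + 1 + t) % n           ≡⟨ cong (_% n) (solve 2 (λ x t → x :+ con 1 :+ t := x :+ t :+ con 1) refl (toℕ x) t) ⟩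
      (toℕ x + t + 1) % n           ≡⟨ sym ([m%d+k]%d≡[m+k]%d (toℕ x + t) 1 n) ⟩
      ((toℕ x + t) % n + 1) % n     ≡⟨ cong (λ z → (z + 1) % n) (sym (toℕ-shift t x)) ⟩
      (toℕ (shift t x) + 1) % n     ∎
      where open ≡-Reasoning
  shift-adjacent t {x} {y} (inj₂ x≡) with shift-adjacent t {y} {x} (inj₁ x≡)
  ... | inj₁ h = inj₂ h
  ... | inj₂ h = inj₁ h

  module Rotation (t : ℕ) (t≤n : t ≤ n) where
    t⁻ : ℕ
    t⁻ = n ∸ t

    back : ∀ x → shift t (shift t⁻ x) ≡ x
    back x = shift-inverse t t⁻ x (m+[n∸m]≡n t≤n)

    forth : ∀ x → shift t⁻ (shift t x) ≡ x
    forth x = shift-inverse t⁻ t x (trans (+-comm t⁻ t) (m+[n∸m]≡n t≤n))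

    avoid : ∀ {x v} → ¬ x ≡ shift t⁻ v → ¬ shift t x ≡ v
    avoid {x} x≢ eq = x≢ (trans (sym (forth x)) (cong (shift t⁻) eq))

    rotate-move : ∀ {r s} → Move n r s → Move n (rotate t r) (rotate t s)
    rotate-move {r} {s} (pebbling v u adj vLoses uGains rest) =
      pebbling (shift t⁻ v) (shift t⁻ u) (shift-adjacent t⁻ adj)
        (subst (λ z → s z + 2 ≡ r z) (sym (back v)) vLoses)
        (subst (λ z → s z ≡ suc (r z)) (sym (back u)) uGains)
        (λ x x≢v x≢u → rest (shift t x) (avoid x≢v) (avoid x≢u))
    rotate-move {r} {s} (rubbling v w u v≢w av aw vLoses wLoses uGains rest) =
      rubbling (shift t⁻ v) (shift t⁻ w) (shift t⁻ u)
        (λ eq → v≢w (trans (sym (back v)) (trans (cong (shift t) eq) (back w))))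
        (shift-adjacent t⁻ av) (shift-adjacent t⁻ aw)
        (subst (λ z → s z + 1 ≡ r z) (sym (back v)) vLoses)
        (subst (λ z → s z + 1 ≡ r z) (sym (back w)) wLoses)
        (subst (λ z → s z ≡ suc (r z)) (sym (back u)) uGains)
        (λ x x≢v x≢w x≢u → rest (shift t x) (avoid x≢v) (avoid x≢w) (avoid x≢u))

    rotate-reach : ∀ {r s} → Reach n r s → Reach n (rotate t r) (rotate t s)
    rotate-reach done = done
    rotate-reach (step mv rest) = step (rotate-move mv) (rotate-reach rest)

  -- If vertex x is 2-reachable from p, then the potential of p seen from x is at least 4:
  -- rotate x to 0, where two pebbles contribute 2 · 2 to the final potential.
  reachable⇒potential≥4 : ∀ (p : Fin n → ℕ) x → Reachable n 2 p x → 4 ≤ potential (toSeq (rotate (toℕ x) p))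
  reachable⇒potential≥4 p x (q , p⇒q , 2≤qx) =
    ≤-trans final (potential-reach (Rotation.rotate-reach (toℕ x) (<⇒≤ (toℕ<n x)) p⇒q))
    where
    shift-to-x : shift (toℕ x) fz ≡ x
    shift-to-x = toℕ-injective (trans (toℕ-shift (toℕ x) fz) (m<n⇒m%n≡m (toℕ<n x)))
    final : 4 ≤ potential (toSeq (rotate (toℕ x) q))
    final = ≤-trans (≤-trans (*-monoʳ-≤ 2 (subst (λ z → 2 ≤ q z) (sym shift-to-x) 2≤qx)) (m≤m+n _ _)) (m≤m+n _ _)

-- A lower bound for the halving gain (F ∸ 1) ∸ (⌊ F/2 ⌋ ∸ 1), namely min (F ∸ 1) 2.
gainBound : ℕ → ℕ
gainBound zero = 0
gainBound (suc zero) = 0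
gainBound (suc (suc zero)) = 1
gainBound (suc (suc (suc _))) = 2

halving-gain : ∀ F → (⌊ F /2⌋ ∸ 1) + gainBound F ≤ F ∸ 1
halving-gain zero = z≤n
halving-gain (suc zero) = z≤n
halving-gain (suc (suc zero)) = s≤s z≤n
halving-gain (suc (suc (suc F))) =
  ≤-trans (≤-reflexive (+-comm ⌊ suc F /2⌋ 2)) (s≤s (s≤s (s≤s⁻¹ (⌊n/2⌋<n F))))

gainBound-sum : ∀ F G → 4 ≤ F + G → 2 ≤ gainBound F + gainBound G
gainBound-sum (suc (suc (suc F))) G _ = m≤m+n 2 _
gainBound-sum F (suc (suc (suc G))) _ = m≤n+m 2 (gainBound F)
gainBound-sum (suc (suc zero)) (suc (suc zero)) _ = s≤s (s≤s z≤n)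
gainBound-sum zero zero ()
gainBound-sum zero (suc zero) (s≤s ())
gainBound-sum zero (suc (suc zero)) (s≤s (s≤s ()))
gainBound-sum (suc zero) zero (s≤s ())
gainBound-sum (suc zero) (suc zero) (s≤s (s≤s ()))
gainBound-sum (suc zero) (suc (suc zero)) (s≤s (s≤s (s≤s ())))
gainBound-sum (suc (suc zero)) zero (s≤s (s≤s ()))
gainBound-sum (suc (suc zero)) (suc zero) (s≤s (s≤s (s≤s ())))

⌊n/2⌋≤n∸1 : ∀ F → ⌊ F /2⌋ ≤ F ∸ 1
⌊n/2⌋≤n∸1 zero = z≤n
⌊n/2⌋≤n∸1 (suc zero) = z≤n
⌊n/2⌋≤n∸1 (suc (suc F)) = s≤s (⌊n/2⌋≤n F)

neighbour-inequality : ∀ P F G F' G' → 4 ≤ 2 * P + F + G → F' ≤ P + ⌊ F /2⌋ → G' ≤ P + ⌊ G /2⌋ →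
                       2 + (F' ∸ 1) + (G' ∸ 1) ≤ 2 * P + (F ∸ 1) + (G ∸ 1)
neighbour-inequality P F G F' G' potential≥4 hF hG =
  ≤-trans (+-mono-≤ (+-monoʳ-≤ 2 (∸-monoˡ-≤ 1 hF)) (∸-monoˡ-≤ 1 hG)) (halves P potential≥4)
  where
  halves : ∀ P → 4 ≤ 2 * P + F + G →
           2 + ((P + ⌊ F /2⌋) ∸ 1) + ((P + ⌊ G /2⌋) ∸ 1) ≤ 2 * P + (F ∸ 1) + (G ∸ 1)
  halves zero F+G≥4 = begin
      2 + (⌊ F /2⌋ ∸ 1) + (⌊ G /2⌋ ∸ 1)                             ≤⟨ +-monoˡ-≤ _ (+-monoˡ-≤ _ (gainBound-sum F G F+G≥4)) ⟩
      gainBound F + gainBound G + (⌊ F /2⌋ ∸ 1) + (⌊ G /2⌋ ∸ 1)     ≡⟨ solve 4 (λ a b x y → a :+ b :+ x :+ y := (x :+ a) :+ (y :+ b)) refl (gainBound F) (gainBound G) (⌊ F /2⌋ ∸ 1) (⌊ G /2⌋ ∸ 1) ⟩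
      ((⌊ F /2⌋ ∸ 1) + gainBound F) + ((⌊ G /2⌋ ∸ 1) + gainBound G) ≤⟨ +-mono-≤ (halving-gain F) (halving-gain G) ⟩
      (F ∸ 1) + (G ∸ 1)                                             ∎
    where open ≤-Reasoning
  halves (suc P) _ = begin
      2 + (P + ⌊ F /2⌋) + (P + ⌊ G /2⌋)     ≤⟨ +-mono-≤ (+-monoʳ-≤ 2 (+-monoʳ-≤ P (⌊n/2⌋≤n∸1 F))) (+-monoʳ-≤ P (⌊n/2⌋≤n∸1 G)) ⟩
      2 + (P + (F ∸ 1)) + (P + (G ∸ 1))     ≡⟨ solve 3 (λ p a b → con 2 :+ (p :+ a) :+ (p :+ b) := con 2 :* (con 1 :+ p) :+ a :+ b) refl P (F ∸ 1) (G ∸ 1) ⟩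
      2 * suc P + (F ∸ 1) + (G ∸ 1)         ∎
    where open ≤-Reasoning

sumTo : (ℕ → ℕ) → ℕ → ℕ
sumTo f zero = 0
sumTo f (suc k) = f 0 + sumTo (shiftSeq f) k

sumTo-cong : ∀ k {f g : ℕ → ℕ} → (∀ i → i < k → f i ≡ g i) → sumTo f k ≡ sumTo g k
sumTo-cong zero eq = refl
sumTo-cong (suc k) eq = cong₂ _+_ (eq 0 (s≤s z≤n)) (sumTo-cong k (λ i i<k → eq (suc i) (s≤s i<k)))

sumTo-scale : ∀ c f k → sumTo (λ i → c * f i) k ≡ c * sumTo f k
sumTo-scale c f zero = sym (*-zeroʳ c)
sumTo-scale c f (suc k) = trans (cong (c * f 0 +_) (sumTo-scale c (shiftSeq f) k)) (sym (*-distribˡ-+ c (f 0) _))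

sumTo-toSeq : ∀ {k} (r : Fin k → ℕ) → sumTo (toSeq r) k ≡ size r
sumTo-toSeq {zero} r = refl
sumTo-toSeq {suc k} r = cong (r fz +_) (sumTo-toSeq (λ x → r (fs x)))

telescope-partial : ∀ c k (u v w : ℕ → ℕ) → (∀ s → s < k → c + u (suc s) + v s ≤ w s + u s + v (suc s)) →
                    k * c + u k + v 0 ≤ sumTo w k + u 0 + v k
telescope-partial c zero u v w local = ≤-refl
telescope-partial c (suc k) u v w local = +-cancelʳ-≤ (u 1 + v 1) _ _ (begin
    suc k * c + u (suc k) + v 0 + (u 1 + v 1)
      ≡⟨ solve 6 (λ kc c uk v0 u1 v1 → c :+ kc :+ uk :+ v0 :+ (u1 :+ v1) := kc :+ uk :+ v1 :+ (c :+ u1 :+ v0)) refl (k * c) c (u (suc k)) (v 0) (u 1) (v 1) ⟩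
    k * c + u (suc k) + v 1 + (c + u 1 + v 0)
      ≤⟨ +-mono-≤ later (local 0 (s≤s z≤n)) ⟩
    sumTo (shiftSeq w) k + u 1 + v (suc k) + (w 0 + u 0 + v 1)
      ≡⟨ solve 6 (λ σ u1 vk w0 u0 v1 → σ :+ u1 :+ vk :+ (w0 :+ u0 :+ v1) := w0 :+ σ :+ u0 :+ vk :+ (u1 :+ v1)) refl (sumTo (shiftSeq w) k) (u 1) (v (suc k)) (w 0) (u 0) (v 1) ⟩
    sumTo w (suc k) + u 0 + v (suc k) + (u 1 + v 1) ∎)
  where
  open ≤-Reasoning
  later : k * c + u (suc k) + v 1 ≤ sumTo (shiftSeq w) k + u 1 + v (suc k)
  later = telescope-partial c k (shiftSeq u) (shiftSeq v) (shiftSeq w) (λ s s<k → local (suc s) (s≤s s<k))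

telescope : ∀ c k (u v w : ℕ → ℕ) → (∀ s → s < k → c + u (suc s) + v s ≤ w s + u s + v (suc s)) →
            u k ≡ u 0 → v k ≡ v 0 → k * c ≤ sumTo w k
telescope c k u v w local uk≡u0 vk≡v0 = +-cancelʳ-≤ (u 0 + v 0) _ _ (begin
    k * c + (u 0 + v 0)          ≡⟨ sym (+-assoc (k * c) (u 0) (v 0)) ⟩
    k * c + u 0 + v 0            ≡⟨ cong (λ z → k * c + z + v 0) (sym uk≡u0) ⟩
    k * c + u k + v 0            ≤⟨ telescope-partial c k u v w local ⟩
    sumTo w k + u 0 + v k        ≡⟨ trans (cong (sumTo w k + u 0 +_) vk≡v0) (+-assoc (sumTo w k) (u 0) (v 0)) ⟩
    sumTo w k + (u 0 + v 0)      ∎)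
  where open ≤-Reasoning

module LowerBound (m : ℕ) (p : Dist (suc (suc (suc m)))) where
  open Cycle m

  pebbles : ℕ → ℕ
  pebbles i = toSeq p (i % n)

  pebbles-periodic : ∀ i → pebbles (i + n) ≡ pebbles i
  pebbles-periodic i = cong (toSeq p) ([m+n]%n≡m%n i n)

  pebbles-shift : ∀ x t → pebbles (x + (t + n)) ≡ pebbles (x + t)
  pebbles-shift x t = trans (cong pebbles (sym (+-assoc x t n))) (pebbles-periodic (x + t))

  ccwValue : ℕ → ℕ
  ccwValue t = pathValue (λ k → pebbles (M ∸ k + t)) M
  cwValue : ℕ → ℕ
  cwValue t = pathValue (λ k → pebbles (suc k + t)) M

  ccwValue-periodic : ∀ t → ccwValue (t + n) ≡ ccwValue t
  ccwValue-periodic t = pathValue-cong M (λ k _ → pebbles-shift (M ∸ k) t)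

  cwValue-periodic : ∀ t → cwValue (t + n) ≡ cwValue t
  cwValue-periodic t = pathValue-cong M (λ k _ → pebbles-shift (suc k) t)

  before : ∀ s → suc (s + M) ≡ s + n
  before s = sym (+-suc s M)

  toSeq-rotate : ∀ t j → j < n → toSeq (rotate t p) j ≡ pebbles (j + t)
  toSeq-rotate t j j<n = begin
    toSeq (rotate t p) j                   ≡⟨ toSeq-fromℕ< (rotate t p) j j<n ⟩
    p (shift t (fromℕ< j<n))               ≡⟨ sym (toSeq-toℕ p (shift t (fromℕ< j<n))) ⟩
    toSeq p (toℕ (shift t (fromℕ< j<n)))   ≡⟨ cong (toSeq p) (toℕ-shift t (fromℕ< j<n)) ⟩
    toSeq p ((toℕ (fromℕ< j<n) + t) % n)   ≡⟨ cong (λ z → toSeq p ((z + t) % n)) (toℕ-fromℕ< j<n) ⟩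
    pebbles (j + t)                        ∎
    where open ≡-Reasoning

  potential-rotate : ∀ t → potential (toSeq (rotate t p)) ≡ 2 * pebbles t + ccwValue t + cwValue t
  potential-rotate t =
    cong₂ _+_ (cong₂ _+_ (cong (2 *_) (toSeq-rotate t 0 (s≤s z≤n)))
                         (pathValue-cong M (λ k _ → toSeq-rotate t (M ∸ k) (s≤s (m∸n≤m M k)))))
              (pathValue-cong M (λ k k<M → toSeq-rotate t (suc k) (s≤s k<M)))

  vertex-bound : Solvable n 2 p → ∀ t → t < n → 4 ≤ 2 * pebbles t + ccwValue t + cwValue t
  vertex-bound solvable t t<n =
    subst (4 ≤_) (trans (cong (λ z → potential (toSeq (rotate z p))) (toℕ-fromℕ< t<n)) (potential-rotate t))
      (reachable⇒potential≥4 p (fromℕ< t<n) (solvable (fromℕ< t<n)))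

  -- The arc leaving vertex t + 1 counterclockwise is vertex t followed by the arc leaving t,
  -- cut one vertex short; symmetrically for the clockwise arcs of t and t + 1.
  ccwValue-next : ∀ t → ccwValue (suc t) ≤ pebbles t + ⌊ ccwValue t /2⌋
  ccwValue-next t = +-mono-≤ (≤-reflexive head≡)
      (⌊n/2⌋-mono (≤-trans (≤-reflexive tail≡) (pathValue-extend (suc m) (λ k → pebbles (M ∸ k + t)))))
    where
    head≡ : pebbles (M + suc t) ≡ pebbles t
    head≡ = trans (cong pebbles (trans (+-suc M t) (+-comm n t))) (pebbles-periodic t)
    tail≡ : pathValue (λ k → pebbles (M ∸ suc k + suc t)) (suc m) ≡ pathValue (λ k → pebbles (M ∸ k + t)) (suc m)
    tail≡ = pathValue-cong (suc m) (λ k k<sm →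
      cong pebbles (trans (+-suc (M ∸ suc k) t) (cong (_+ t) (sym (+-∸-assoc 1 {M} {suc k} (m≤n⇒m≤1+n k<sm))))))

  cwValue-prev : ∀ t → cwValue t ≤ pebbles (suc t) + ⌊ cwValue (suc t) /2⌋
  cwValue-prev t = +-monoʳ-≤ (pebbles (suc t))
      (⌊n/2⌋-mono (≤-trans (≤-reflexive tail≡) (pathValue-extend (suc m) (λ k → pebbles (suc k + suc t)))))
    where
    tail≡ : pathValue (λ k → pebbles (suc (suc k) + t)) (suc m) ≡ pathValue (λ k → pebbles (suc k + suc t)) (suc m)
    tail≡ = pathValue-cong (suc m) (λ k _ → cong pebbles (sym (+-suc (suc k) t)))

  -- Summing the neighbour inequality around the cycle, with u s = F(s) ∸ 1 and
  -- v s = G(s - 1) ∸ 1, the arc terms cancel and 2n ≤ 2 · size p remains.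
  size-bound : Solvable n 2 p → n ≤ size p
  size-bound solvable = *-cancelˡ-≤ 2 (subst₂ _≤_ (*-comm n 2) total
                          (telescope 2 n u v w local (cong (_∸ 1) (ccwValue-periodic 0)) v-periodic))
    where
    u v w : ℕ → ℕ
    u s = ccwValue s ∸ 1
    v s = cwValue (s + M) ∸ 1
    w s = 2 * pebbles s

    cwValue-before : ∀ s → cwValue (suc (s + M)) ≡ cwValue s
    cwValue-before s = trans (cong cwValue (before s)) (cwValue-periodic s)

    cwValue-into : ∀ s → cwValue (s + M) ≤ pebbles s + ⌊ cwValue s /2⌋
    cwValue-into s = subst₂ (λ a b → cwValue (s + M) ≤ a + ⌊ b /2⌋)
      (trans (cong pebbles (before s)) (pebbles-periodic s)) (cwValue-before s) (cwValue-prev (s + M))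

    local : ∀ s → s < n → 2 + u (suc s) + v s ≤ w s + u s + v (suc s)
    local s s<n = subst (λ g → 2 + u (suc s) + v s ≤ w s + u s + (g ∸ 1)) (sym (cwValue-before s))
      (neighbour-inequality (pebbles s) (ccwValue s) (cwValue s) (ccwValue (suc s)) (cwValue (s + M))
        (vertex-bound solvable s s<n) (ccwValue-next s) (cwValue-into s))

    v-periodic : v n ≡ v 0
    v-periodic = cong (_∸ 1) (trans (cong cwValue (+-comm n M)) (cwValue-periodic M))

    total : sumTo w n ≡ 2 * size p
    total = trans (sumTo-scale 2 pebbles n)
              (cong (2 *_) (trans (sumTo-cong n (λ i i<n → cong (toSeq p) (m<n⇒m%n≡m i<n))) (sumTo-toSeq p)))

module UpperBound (m : ℕ) where
  open Cycle m

  ones : Dist n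
  ones _ = 1

  last : Fin n
  last = fromℕ M

  afterMove : Dist n
  afterMove fz = 2
  afterMove (fs fz) = 0
  afterMove (fs (fs y)) with toℕ y ≟ m
  ... | yes _ = 0
  ... | no _ = 1

  afterMove-last : afterMove last ≡ 0
  afterMove-last with toℕ (fromℕ m) ≟ m
  ... | yes _ = refl
  ... | no ne = ⊥-elim (ne (toℕ-fromℕ m))

  afterMove-rest : ∀ x → ¬ x ≡ last → ¬ x ≡ fs fz → ¬ x ≡ fz → afterMove x ≡ ones x
  afterMove-rest fz _ _ x≢0 = ⊥-elim (x≢0 refl)
  afterMove-rest (fs fz) _ x≢1 _ = ⊥-elim (x≢1 refl)
  afterMove-rest (fs (fs y)) x≢last _ _ with toℕ y ≟ m
  ... | yes y≡m = ⊥-elim (x≢last (cong (λ z → fs (fs z)) (toℕ-injective (trans y≡m (sym (toℕ-fromℕ m))))))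
  ... | no _ = refl

  last-adjacent : Adj n last fz
  last-adjacent = inj₁ (sym (trans (cong (λ z → (z + 1) % n) (toℕ-fromℕ M))
                                    (trans (cong (_% n) (+-comm M 1)) (n%n≡0 n))))

  one-adjacent : Adj n (fs fz) fz
  one-adjacent = inj₂ (sym (m<n⇒m%n≡m 1<n))
    where
    1<n : 1 < n
    1<n = s≤s (s≤s z≤n)

  last≢1 : ¬ last ≡ fs fz
  last≢1 ()

  rubbling-to-0 : Move n ones afterMove
  rubbling-to-0 = rubbling last (fs fz) fz last≢1 last-adjacent one-adjacent
                    (cong (_+ 1) afterMove-last) refl refl afterMove-rest

  ones-solvable : Solvable n 2 ones
  ones-solvable t = rotate a afterMove , Rotation.rotate-reach a (m∸n≤m n (toℕ t)) (step rubbling-to-0 done) ,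
                    ≤-reflexive (sym (cong afterMove shift-t≡0))
    where
    a : ℕ
    a = n ∸ toℕ t
    shift-t≡0 : shift a t ≡ fz
    shift-t≡0 = toℕ-injective (trans (toℕ-shift a t) (trans (cong (_% n) (m+[n∸m]≡n (<⇒≤ (toℕ<n t)))) (n%n≡0 n)))

  size-ones : ∀ k → size (λ (_ : Fin k) → 1) ≡ k
  size-ones zero = refl
  size-ones (suc k) = cong suc (size-ones k)

theorem2 : (n : ℕ) .{{_ : NonZero n}} → 3 ≤ n → IsOptimalRubblingNumber n 2 n
theorem2 (suc zero) (s≤s ())
theorem2 (suc (suc zero)) (s≤s (s≤s ()))
theorem2 (suc (suc (suc m))) _ =
  (ones , ones-solvable , size-ones _) , (λ p solvable → LowerBound.size-bound m p solvable)
  where open UpperBound m
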